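{- For every $a\in\mathbb{N}^*$, the fragment $\mathcal{H}^c_{a,\infty}$ is reducible to $\mathcal{H}^c_{a,2}$.
   Context: Clauses and fragments. - Clauses are function-free second-order Horn clauses: a head (at most one positive literal) and a finite body of negative literals. Each literal is a predicate variable of arity in $\mathbb{N}^*$ applied to term variables. - The body size $|C|$ is the number of body literals. - A clause is connected if its literals cannot be partitioned into two non-empty sets with disjoint sets of variables. $\mathcal{H}^c$ is the set of connected clauses. - $\mathcal{F}_{a,b}$ denotes the clauses of $\mathcal{F}$ with all literal arities at most $a$ and body size at most $b$; $\infty$ means no bound. - Fragments are considered modulo variable renaming and contain only the most general clauses up to variable unification: for each clause $C$ satisfying the syntactic restrictions there is a clause $C_{\mathcal{F}}$ in the fragment with $C_{\mathcal{F}}\sigma=C$ for some substitution $\sigma$. Accordingly, inferences are taken modulo variable unification. SLD-resolution. - Substitutions map term variables to term variables and predicate variables to predicate variables of the same arity. - An SLD-resolution inference $C_1,C_2\vdash C$ is binary resolution without factoring: a body literal of one premise is unified by a most general unifier with the head of the other, and the resolvent consists of the remaining literals with the unifier applied. Reducibility. A fragment $\mathcal{F}$ is reducible to $\mathcal{F}_{\infty,b}$ if, for every $C\in\mathcal{F}$ with $b<|C|$, there exists $b'<|C|$ such that $C$ is the resolvent of an SLD-inference whose premises lie in $\mathcal{F}_{\infty,b'}$. Here $(\mathcal{H}^c_{a,\infty})_{\infty,b'}=\mathcal{H}^c_{a,b'}$. -}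

module Defs where

open import Data.Nat using (ℕ; suc; _≤_; _<_)
open import Data.Bool using (Bool; true; false)
open import Data.Maybe using (Maybe; just; nothing)
open import Data.List using (List; []; _∷_; _++_; length; map; lookup)
open import Data.Vec using (Vec; toList) renaming (map to vmap)
open import Data.Fin using (Fin)
open import Data.Product using (Σ; ∃; ∃-syntax; _×_; _,_)
open import Data.Empty using (⊥)
open import Relation.Nullary using (¬_)
open import Relation.Binary.PropositionalEquality using (_≡_)
open import Data.List.Membership.Propositional using (_∈_)
open import Data.List.Relation.Binary.Permutation.Propositional using (_↭_)

-- A predicate variable of arity
-- (suc k) is a natural number p together with its arity: the symbol is
-- the pair (suc k , p), so predicate variables of different arities are
-- distinct.  Arities are in ℕ* because they are of the form suc k.

record Literal : Set where
  constructor lit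
  field
    k    : ℕ
    pred : ℕ
    args : Vec ℕ (suc k)

open Literal public

arity : Literal → ℕ
arity L = suc (k L)

tvars : Literal → List ℕ
tvars L = toList (args L)

-- A clause: at most one positive literal (the head) and a finite
-- body of negative literals (a list, read up to permutation, i.e. a
-- multiset: resolution is without factoring).
record Clause : Set where
  constructor clause
  field
    head : Maybe Literal
    body : List Literal

open Clause public

headList : Maybe Literal → List Literal
headList nothing  = []
headList (just h) = h ∷ []

literals : Clause → List Literal
literals C = headList (head C) ++ body C

size : Clause → ℕ
size C = length (body C)

-- A partition of the
-- literal occurrences is a colouring f of their positions by Bool.

ShareVar : Literal → Literal → Set
ShareVar L M = ∃[ x ] (x ∈ tvars L × x ∈ tvars M)

Connected : Clause → Set
Connected C =
  (f : Fin (length (literals C)) → Bool) →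
  ∃[ i ] (f i ≡ true) → ∃[ j ] (f j ≡ false) →
  ∃[ i ] ∃[ j ] (f i ≡ true × f j ≡ false ×
     ShareVar (lookup (literals C) i) (lookup (literals C) j))

AritiesAtMost : ℕ → Clause → Set
AritiesAtMost a C = ∀ L → L ∈ literals C → arity L ≤ a

InHc∞ : ℕ → Clause → Set
InHc∞ a C = Connected C × AritiesAtMost a C

InHc : ℕ → ℕ → Clause → Set
InHc a b C = InHc∞ a C × size C ≤ b

record Subst : Set where
  constructor subst
  field
    tv : ℕ → ℕ
    pv : ℕ → ℕ → ℕ     -- pv k p : image of the predicate variable p of arity suc k

open Subst public

applyL : Subst → Literal → Literal
applyL σ (lit k p xs) = lit k (pv σ k p) (vmap (tv σ) xs)

applyM : Subst → Maybe Literal → Maybe Literal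
applyM σ nothing  = nothing
applyM σ (just L) = just (applyL σ L)

applyC : Subst → Clause → Clause
applyC σ (clause h b) = clause (applyM σ h) (map (applyL σ) b)

_≗ₛ_∘ₛ_ : Subst → Subst → Subst → Set
τ ≗ₛ δ ∘ₛ θ = (∀ x → tv τ x ≡ tv δ (tv θ x)) ×
              (∀ k p → pv τ k p ≡ pv δ k (pv θ k p))

Unifier : Subst → Literal → Literal → Set
Unifier θ L M = applyL θ L ≡ applyL θ M

MGU : Subst → Literal → Literal → Set
MGU θ L M = Unifier θ L M ×
  (∀ τ → Unifier τ L M → ∃[ δ ] (τ ≗ₛ δ ∘ₛ θ))

TVarsOf : Clause → ℕ → Set
TVarsOf C x = ∃[ L ] (L ∈ literals C × x ∈ tvars L)

PVarsOf : Clause → ℕ → ℕ → Set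
PVarsOf C kk p = ∃[ L ] (L ∈ literals C × k L ≡ kk × pred L ≡ p)

Apart : Clause → Clause → Set
Apart C₁ C₂ = (∀ x → TVarsOf C₁ x → TVarsOf C₂ x → ⊥) ×
              (∀ kk p → PVarsOf C₁ kk p → PVarsOf C₂ kk p → ⊥)

-- The premises are taken renamed apart; both orders of
-- premises are covered by quantifying over them.

SLD : Clause → Clause → Clause → Set
SLD C₁ C₂ R =
  Apart C₁ C₂ ×
  ∃[ h ] (head C₁ ≡ just h ×
  ∃[ pre ] ∃[ L ] ∃[ post ] (body C₂ ≡ pre ++ L ∷ post ×
  ∃[ θ ] (MGU θ h L ×
     R ≡ clause (applyM θ (head C₂))
                (map (applyL θ) (body C₁) ++ map (applyL θ) (pre ++ post)))))

_≈ᶜ_ : Clause → Clause → Set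
C ≈ᶜ D = head C ≡ head D × body C ↭ body D

InstanceOf : Clause → Clause → Set
InstanceOf C R = ∃[ σ ] (C ≈ᶜ applyC σ R)

ReducibleHc : ℕ → ℕ → Set
ReducibleHc a b =
  ∀ C → InHc∞ a C → b < size C →
  ∃[ b' ] (b' < size C ×
    ∃[ C₁ ] ∃[ C₂ ] ∃[ R ]
      (InHc a b' C₁ × InHc a b' C₂ × SLD C₁ C₂ R × InstanceOf C R))

module Submission where

-- Order the literals of a connected clause C as a chain rooted at its head (or, for a goal
-- clause, at one body literal): every body literal shares a variable with the root or with a
-- later literal.  Removing the first literal X of the chain leaves a connected clause C − X,
-- and X shares a variable with some literal Y of C − X.  Resolving on Y, C is then obtained
-- from C − X and the bridge clause Y ← Y, X; if Y is the head of C, the bridge is the second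
-- premise, otherwise the first.  Both premises are connected and have at most |C| − 1 body
-- literals, which is at least 2.  The premises are renamed apart by x ↦ 2x + 1 and x ↦ 2x,
-- the mgu merges the odd copy of Y into the even one, and halving every variable turns the
-- resolvent back into C.

open import Defs renaming (subst to mkSubst)
open import Data.Nat using (ℕ; zero; suc; _+_; _<_; _≤_; ⌊_/2⌋; _≟_)
open import Data.Nat.Properties
  using (≤-refl; ≤-pred; n≮0; suc-injective; n≡⌊n+n/2⌋; n≡⌈n+n/2⌉; 1+n≢n)
open import Data.Bool using (Bool; true; false)
open import Data.Maybe using (just; nothing)
open import Data.List using (List; []; _∷_; _++_; length; map; lookup)
open import Data.List.Properties using (length-map; map-++; ++-identityʳ)
open import Data.Vec using (Vec; toList) renaming (map to vmap; [] to []ᵥ; _∷_ to _∷ᵥ_)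
import Data.Vec.Properties as Vec
open import Data.Fin using (Fin; zero; suc; cast)
open import Data.Fin.Properties using (cast-involutive)
open import Data.Fin.Permutation using (_⟨$⟩ʳ_; _⟨$⟩ˡ_; inverseʳ)
open import Data.Product using (∃; ∃-syntax; _×_; _,_)
open import Data.Sum using (inj₁; inj₂)
open import Data.Empty using (⊥; ⊥-elim)
open import Function using (_∘_)
open import Relation.Nullary using (yes; no)
open import Relation.Binary.PropositionalEquality
  using (_≡_; refl; sym; trans; cong; cong₂; subst; subst₂; setoid; module ≡-Reasoning)
open import Data.List.Membership.Propositional using (_∈_; find; lose)
open import Data.List.Membership.Propositional.Properties
  using (∈-lookup; ∈-map⁺; ∈-map⁻; ∈-++⁻; ∈-++⁺ʳ; ∈-∃++)
import Data.List.Membership.DecPropositional as DecMembership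
open import Data.List.Relation.Unary.Any using (Any; here; there; index)
open import Data.List.Relation.Unary.Any.Properties using (lookup-index)
open import Data.List.Relation.Binary.Subset.Propositional using (_⊆_)
open import Data.List.Relation.Binary.Subset.Propositional.Properties
  using (⊆-trans; ⊆-reflexive-↭; xs⊆x∷xs; ++⁺ʳ; ∈-∷⁺ʳ)
open import Data.List.Relation.Binary.Permutation.Propositional
  using (_↭_; ↭-refl; ↭-reflexive; ↭-sym; ↭-trans; prep; swap; ↭⇒↭ₛ; module PermutationReasoning)
open import Data.List.Relation.Binary.Permutation.Propositional.Properties
  using (↭-length; shift; ∷↭∷ʳ; ++⁺ˡ; ∈-resp-↭)
open import Data.List.Relation.Binary.Permutation.Setoid (setoid Literal) using (onIndices)
open import Data.List.Relation.Binary.Permutation.Setoid.Properties (setoid Literal)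
  using (onIndices-lookup)

open DecMembership _≟_ using (_∈?_)

ShareVar-sym : ∀ {L M} → ShareVar L M → ShareVar M L
ShareVar-sym (x , x∈L , x∈M) = x , x∈M , x∈L

ShareVar-refl : ∀ L → ShareVar L L
ShareVar-refl (lit k p (x ∷ᵥ xs)) = x , here refl , here refl

-- Connected C unfolds to ConnectedLits (literals C).
ConnectedLits : List Literal → Set
ConnectedLits ls =
  (f : Fin (length ls) → Bool) →
  ∃[ i ] (f i ≡ true) → ∃[ j ] (f j ≡ false) →
  ∃[ i ] ∃[ j ] (f i ≡ true × f j ≡ false × ShareVar (lookup ls i) (lookup ls j))

ConnectedLits-transport :
  ∀ {xs ys} (to : Fin (length xs) → Fin (length ys)) (from : Fin (length ys) → Fin (length xs)) →
  (∀ k → to (from k) ≡ k) →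
  (∀ i j → ShareVar (lookup xs i) (lookup xs j) → ShareVar (lookup ys (to i)) (lookup ys (to j))) →
  ConnectedLits xs → ConnectedLits ys
ConnectedLits-transport to from to∘from share conn f (k , fk) (l , fl)
  with i , j , fi , fj , s ← conn (f ∘ to) (from k , trans (cong f (to∘from k)) fk)
                                          (from l , trans (cong f (to∘from l)) fl)
  = to i , to j , fi , fj , share i j s

ConnectedLits-resp-↭ : ∀ {xs ys} → xs ↭ ys → ConnectedLits xs → ConnectedLits ys
ConnectedLits-resp-↭ {xs} {ys} xs↭ys =
  ConnectedLits-transport {xs} {ys} (π ⟨$⟩ʳ_) (π ⟨$⟩ˡ_) (λ _ → inverseʳ π)
    (λ i j → subst₂ ShareVar (onIndices-lookup p i) (onIndices-lookup p j))
  where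
  p = ↭⇒↭ₛ xs↭ys
  π = onIndices p

lookup-map : ∀ {A B : Set} (f : A → B) xs i →
             lookup (map f xs) i ≡ f (lookup xs (cast (length-map f xs) i))
lookup-map f (x ∷ xs) zero    = refl
lookup-map f (x ∷ xs) (suc i) = lookup-map f xs i

tvars-applyL : ∀ ρ L → tvars (applyL ρ L) ≡ map (tv ρ) (tvars L)
tvars-applyL ρ L = Vec.toList-map (tv ρ) (args L)

ShareVar-applyL : ∀ ρ {L M} → ShareVar L M → ShareVar (applyL ρ L) (applyL ρ M)
ShareVar-applyL ρ {L} {M} (x , x∈L , x∈M) =
  tv ρ x , subst (tv ρ x ∈_) (sym (tvars-applyL ρ L)) (∈-map⁺ (tv ρ) x∈L)
         , subst (tv ρ x ∈_) (sym (tvars-applyL ρ M)) (∈-map⁺ (tv ρ) x∈M)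

ConnectedLits-map-applyL : ∀ ρ xs → ConnectedLits xs → ConnectedLits (map (applyL ρ) xs)
ConnectedLits-map-applyL ρ xs =
  ConnectedLits-transport {xs} {map f xs} (cast (sym n≡)) (cast n≡) (cast-involutive (sym n≡) n≡)
    share
  where
  f = applyL ρ
  n≡ = length-map f xs
  lookup-image : ∀ i → lookup (map f xs) (cast (sym n≡) i) ≡ f (lookup xs i)
  lookup-image i = trans (lookup-map f xs (cast (sym n≡) i))
                         (cong (f ∘ lookup xs) (cast-involutive n≡ (sym n≡) i))
  share : ∀ i j → ShareVar (lookup xs i) (lookup xs j) →
          ShareVar (lookup (map f xs) (cast (sym n≡) i)) (lookup (map f xs) (cast (sym n≡) j))
  share i j s = subst₂ ShareVar (sym (lookup-image i)) (sym (lookup-image j))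
                       (ShareVar-applyL ρ {lookup xs i} {lookup xs j} s)

ConnectedLits-[_] : ∀ L → ConnectedLits (L ∷ [])
ConnectedLits-[ L ] f (zero , f0≡true) (zero , f0≡false) with () ← trans (sym f0≡true) f0≡false

ConnectedLits-∷ : ∀ {L xs} → Any (ShareVar L) xs → ConnectedLits xs → ConnectedLits (L ∷ xs)
ConnectedLits-∷ {L} {xs} L~xs conn f = crossing
  where
  Crossing : Set
  Crossing = ∃[ i ] ∃[ j ] (f i ≡ true × f j ≡ false ×
                            ShareVar (lookup (L ∷ xs) i) (lookup (L ∷ xs) j))
  t = index L~xs
  L~t : ShareVar L (lookup xs t)
  L~t = lookup-index L~xs
  inTail : ∃[ i ] (f (suc i) ≡ true) → ∃[ j ] (f (suc j) ≡ false) → Crossing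
  inTail tl fl with i , j , fi , fj , s ← conn (f ∘ suc) tl fl = suc i , suc j , fi , fj , s
  -- When L and the literal at t it is linked to get different colours, they cross;
  -- otherwise t can replace L as a witness inside the tail.
  crossing : ∃[ i ] (f i ≡ true) → ∃[ j ] (f j ≡ false) → Crossing
  crossing (zero , f0) (zero , f0′) with () ← trans (sym f0) f0′
  crossing (suc i , fi) (suc j , fj) = inTail (i , fi) (j , fj)
  crossing (zero , f0) (suc j , fj) with f (suc t) in ft
  ... | false = zero , suc t , f0 , ft , L~t
  ... | true  = inTail (t , ft) (j , fj)
  crossing (suc i , fi) (zero , f0) with f (suc t) in ft
  ... | true  = suc t , zero , ft , f0 , ShareVar-sym {L} {lookup xs t} L~t
  ... | false = inTail (i , fi) (t , ft)

inRight : ∀ xs {ys : List Literal} → Fin (length (xs ++ ys)) → Bool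
inRight []       i       = true
inRight (x ∷ xs) zero    = false
inRight (x ∷ xs) (suc i) = inRight xs i

inRight-true : ∀ xs {ys} i → inRight xs {ys} i ≡ true → lookup (xs ++ ys) i ∈ ys
inRight-true []       i       _ = ∈-lookup i
inRight-true (x ∷ xs) (suc i) e = inRight-true xs i e

inRight-false : ∀ xs {ys} i → inRight xs {ys} i ≡ false → lookup (xs ++ ys) i ∈ xs
inRight-false (x ∷ xs) zero    _ = here refl
inRight-false (x ∷ xs) (suc i) e = there (inRight-false xs i e)

inRight-witness : ∀ xs {y ys} → ∃[ i ] (inRight xs {y ∷ ys} i ≡ true)
inRight-witness []       = zero , refl
inRight-witness (x ∷ xs) with i , e ← inRight-witness xs = suc i , e

ConnectedLits-++⇒link : ∀ {x xs y ys} → ConnectedLits ((x ∷ xs) ++ y ∷ ys) →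
                        Any (λ M → Any (ShareVar M) (x ∷ xs)) (y ∷ ys)
ConnectedLits-++⇒link {x} {xs} conn
  with i , j , ri , lj , i~j ← conn (inRight (x ∷ xs)) (inRight-witness (x ∷ xs)) (zero , refl)
  = lose (inRight-true (x ∷ xs) i ri) (lose (inRight-false (x ∷ xs) j lj) i~j)

data ChainTo (r : Literal) : List Literal → Set where
  []  : ChainTo r []
  _∷_ : ∀ {L xs} → Any (ShareVar L) (r ∷ xs) → ChainTo r xs → ChainTo r (L ∷ xs)

ChainTo⇒ConnectedLits : ∀ {r xs} → ChainTo r xs → ConnectedLits (r ∷ xs)
ChainTo⇒ConnectedLits {r} []              = ConnectedLits-[ r ]
ChainTo⇒ConnectedLits {r} (_∷_ {L} L~ ch) =
  ConnectedLits-resp-↭ (swap L r ↭-refl) (ConnectedLits-∷ L~ (ChainTo⇒ConnectedLits ch))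

-- Greedily move to the chain a remaining literal linked to it; connectedness of r ∷ B
-- guarantees one exists as long as literals remain.
chainOrdering : ∀ {r B} → ConnectedLits (r ∷ B) → ∃[ M ] (M ↭ B × ChainTo r M)
chainOrdering {r} {B} conn = grow (length B) [] B refl ↭-refl []
  where
  grow : ∀ n M rest → length rest ≡ n → M ++ rest ↭ B → ChainTo r M →
         ∃[ M′ ] (M′ ↭ B × ChainTo r M′)
  grow _ M [] _ M↭B ch = M , subst (_↭ B) (++-identityʳ M) M↭B , ch
  grow (suc n) M (x ∷ rest) len M↭B ch
    with L , L∈ , L~ ← find (ConnectedLits-++⇒link (ConnectedLits-resp-↭ (prep r (↭-sym M↭B)) conn))
    with u , v , x∷rest≡ ← ∈-∃++ L∈
    = grow n (L ∷ M) (u ++ v) len′ M′↭B (L~ ∷ ch)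
    where
    len′ : length (u ++ v) ≡ n
    len′ = suc-injective (begin
      suc (length (u ++ v))   ≡⟨ ↭-length (shift L u v) ⟨
      length (u ++ L ∷ v)     ≡⟨ cong length x∷rest≡ ⟨
      length (x ∷ rest)       ≡⟨ len ⟩
      suc n                   ∎)
      where open ≡-Reasoning
    M′↭B : (L ∷ M) ++ u ++ v ↭ B
    M′↭B = begin
      L ∷ M ++ u ++ v   ↭⟨ shift L M (u ++ v) ⟨
      M ++ L ∷ u ++ v   ↭⟨ ++⁺ˡ M (shift L u v) ⟨
      M ++ u ++ L ∷ v   ≡⟨ cong (M ++_) x∷rest≡ ⟨
      M ++ x ∷ rest     ↭⟨ M↭B ⟩
      B                 ∎
      where open PermutationReasoning

literals-applyC : ∀ ρ C → literals (applyC ρ C) ≡ map (applyL ρ) (literals C)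
literals-applyC ρ (clause nothing  b) = refl
literals-applyC ρ (clause (just h) b) = refl

∈-literals-applyC : ∀ ρ C {L} → L ∈ literals (applyC ρ C) →
                    ∃[ L′ ] (L′ ∈ literals C × L ≡ applyL ρ L′)
∈-literals-applyC ρ C L∈ = ∈-map⁻ (applyL ρ) (subst (_ ∈_) (literals-applyC ρ C) L∈)

Connected-applyC : ∀ ρ C → Connected C → Connected (applyC ρ C)
Connected-applyC ρ C conn =
  subst ConnectedLits (sym (literals-applyC ρ C)) (ConnectedLits-map-applyL ρ (literals C) conn)

AritiesAtMost-applyC : ∀ {a} ρ C → AritiesAtMost a C → AritiesAtMost a (applyC ρ C)
AritiesAtMost-applyC ρ C ar L L∈ with L′ , L′∈ , refl ← ∈-literals-applyC ρ C L∈ = ar L′ L′∈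

AritiesAtMost-⊆ : ∀ {a} C D → literals D ⊆ literals C → AritiesAtMost a C → AritiesAtMost a D
AritiesAtMost-⊆ C D D⊆C ar L L∈D = ar L (D⊆C L∈D)

InHc-applyC : ∀ {a b} ρ C → InHc a b C → InHc a b (applyC ρ C)
InHc-applyC ρ C ((conn , ar) , size≤) =
  (Connected-applyC ρ C conn , AritiesAtMost-applyC ρ C ar) ,
  subst (_≤ _) (sym (length-map (applyL ρ) (body C))) size≤

applyL-∘ : ∀ {ρ σ τ} → ρ ≗ₛ σ ∘ₛ τ → ∀ L → applyL σ (applyL τ L) ≡ applyL ρ L
applyL-∘ {ρ} {σ} {τ} (tv≗ , pv≗) (lit k p xs) =
  cong₂ (lit k) (sym (pv≗ k p))
        (trans (sym (Vec.map-∘ (tv σ) (tv τ) xs)) (Vec.map-cong (sym ∘ tv≗) xs))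

-- Renaming apart by parity

even odd : ℕ → ℕ
even n = n + n
odd  n = suc (n + n)

⌊even/2⌋ : ∀ n → ⌊ even n /2⌋ ≡ n
⌊even/2⌋ n = sym (n≡⌊n+n/2⌋ n)

⌊odd/2⌋ : ∀ n → ⌊ odd n /2⌋ ≡ n
⌊odd/2⌋ n = sym (n≡⌈n+n/2⌉ n)

odd≢even : ∀ m n → odd m ≡ even n → ⊥
odd≢even m n e with refl ← trans (sym (⌊odd/2⌋ m)) (trans (cong ⌊_/2⌋ e) (⌊even/2⌋ n)) = 1+n≢n e

renameBy : (ℕ → ℕ) → Subst
renameBy f = mkSubst f (λ _ → f)

evenS oddS halveS : Subst
evenS  = renameBy even
oddS   = renameBy odd
halveS = renameBy ⌊_/2⌋

halve-renameBy : ∀ {f} → (∀ n → ⌊ f n /2⌋ ≡ n) → ∀ L → applyL halveS (applyL (renameBy f) L) ≡ L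
halve-renameBy {f} halve∘f (lit k p xs) =
  cong₂ (lit k) (halve∘f p)
        (trans (sym (Vec.map-∘ ⌊_/2⌋ f xs)) (trans (Vec.map-cong halve∘f xs) (Vec.map-id xs)))

TVarsOf-renameBy : ∀ f C {x} → TVarsOf (applyC (renameBy f) C) x → ∃[ y ] (x ≡ f y)
TVarsOf-renameBy f C (L , L∈ , x∈L)
  with L′ , _ , refl ← ∈-literals-applyC (renameBy f) C L∈
  with y , _ , x≡ ← ∈-map⁻ f (subst (_ ∈_) (tvars-applyL (renameBy f) L′) x∈L)
  = y , x≡

PVarsOf-renameBy : ∀ f C {kk p} → PVarsOf (applyC (renameBy f) C) kk p → ∃[ q ] (p ≡ f q)
PVarsOf-renameBy f C (L , L∈ , _ , p≡)
  with L′ , _ , refl ← ∈-literals-applyC (renameBy f) C L∈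
  = pred L′ , sym p≡

Apart-odd-even : ∀ C₁ C₂ → Apart (applyC oddS C₁) (applyC evenS C₂)
Apart-odd-even C₁ C₂ =
  (λ x x∈C₁ x∈C₂ → apart (TVarsOf-renameBy odd C₁ x∈C₁) (TVarsOf-renameBy even C₂ x∈C₂)) ,
  (λ kk p p∈C₁ p∈C₂ → apart (PVarsOf-renameBy odd C₁ p∈C₁) (PVarsOf-renameBy even C₂ p∈C₂))
  where
  apart : ∀ {x} → ∃[ m ] (x ≡ odd m) → ∃[ n ] (x ≡ even n) → ⊥
  apart (m , refl) (n , e) = odd≢even m n e

vmap-cong-∈ : ∀ {n} {f g : ℕ → ℕ} (v : Vec ℕ n) →
              (∀ {x} → x ∈ toList v → f x ≡ g x) → vmap f v ≡ vmap g v
vmap-cong-∈ []ᵥ      f≗g = refl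
vmap-cong-∈ (x ∷ᵥ v) f≗g = cong₂ _∷ᵥ_ (f≗g (here refl)) (vmap-cong-∈ v (f≗g ∘ there))

vmap-≡-∈ : ∀ {n} {f g : ℕ → ℕ} (v : Vec ℕ n) →
           vmap f v ≡ vmap g v → ∀ {x} → x ∈ toList v → f x ≡ g x
vmap-≡-∈ (y ∷ᵥ v) e (here refl) = Vec.∷-injectiveˡ e
vmap-≡-∈ (y ∷ᵥ v) e (there x∈) = vmap-≡-∈ v (Vec.∷-injectiveʳ e) x∈

args-injective : ∀ {k p q} {xs ys : Vec ℕ (suc k)} → lit k p xs ≡ lit k q ys → xs ≡ ys
args-injective refl = refl

module OddEvenMgu (P : Literal) where

  θ-tv : ℕ → ℕ
  θ-tv x with x ∈? tvars (applyL oddS P)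
  ... | yes _ = even ⌊ x /2⌋
  ... | no  _ = x

  θ-pv : ℕ → ℕ → ℕ
  θ-pv kk q with kk ≟ k P | q ≟ odd (pred P)
  ... | yes _ | yes _ = even (pred P)
  ... | yes _ | no  _ = q
  ... | no  _ | _     = q

  θ : Subst
  θ = mkSubst θ-tv θ-pv

  θ-tv-odd : ∀ {x} → x ∈ tvars (applyL oddS P) → θ-tv x ≡ even ⌊ x /2⌋
  θ-tv-odd {x} x∈ with x ∈? tvars (applyL oddS P)
  ... | yes _ = refl
  ... | no x∉ = ⊥-elim (x∉ x∈)

  θ-tv-even : ∀ n → θ-tv (even n) ≡ even n
  θ-tv-even n with even n ∈? tvars (applyL oddS P)
  ... | yes _ = cong even (⌊even/2⌋ n)
  ... | no  _ = refl

  θ-pv-even : ∀ kk n → θ-pv kk (even n) ≡ even n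
  θ-pv-even kk n with kk ≟ k P | even n ≟ odd (pred P)
  ... | yes _ | yes e = ⊥-elim (odd≢even (pred P) n (sym e))
  ... | yes _ | no  _ = refl
  ... | no  _ | _     = refl

  θ-pv-odd : θ-pv (k P) (odd (pred P)) ≡ even (pred P)
  θ-pv-odd with k P ≟ k P | odd (pred P) ≟ odd (pred P)
  ... | yes _ | yes _ = refl
  ... | yes _ | no ≢  = ⊥-elim (≢ refl)
  ... | no ≢  | _     = ⊥-elim (≢ refl)

  θ-unifies : Unifier θ (applyL oddS P) (applyL evenS P)
  θ-unifies = cong₂ (lit (k P)) (trans θ-pv-odd (sym (θ-pv-even (k P) (pred P)))) args-unify
    where
    open ≡-Reasoning
    ys = args P
    args-unify : vmap θ-tv (vmap odd ys) ≡ vmap θ-tv (vmap even ys)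
    args-unify = begin
      vmap θ-tv (vmap odd ys)              ≡⟨ vmap-cong-∈ (vmap odd ys) θ-tv-odd ⟩
      vmap (even ∘ ⌊_/2⌋) (vmap odd ys)    ≡⟨ Vec.map-∘ (even ∘ ⌊_/2⌋) odd ys ⟨
      vmap (even ∘ ⌊_/2⌋ ∘ odd) ys         ≡⟨ Vec.map-cong (cong even ∘ ⌊odd/2⌋) ys ⟩
      vmap even ys                         ≡⟨ Vec.map-cong θ-tv-even ys ⟨
      vmap (θ-tv ∘ even) ys                ≡⟨ Vec.map-∘ θ-tv even ys ⟩
      vmap θ-tv (vmap even ys)             ∎

  θ-mgu : MGU θ (applyL oddS P) (applyL evenS P)
  θ-mgu = θ-unifies , λ τ τ-unifies → τ , tv-factors τ τ-unifies , pv-factors τ τ-unifies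
    where
    ys = args P
    tv-factors : ∀ τ → Unifier τ (applyL oddS P) (applyL evenS P) →
                 ∀ x → tv τ x ≡ tv τ (θ-tv x)
    tv-factors τ τ-unifies x with x ∈? tvars (applyL oddS P)
    ... | no  _  = refl
    ... | yes x∈ with z , z∈ , refl ← ∈-map⁻ odd (subst (x ∈_) (Vec.toList-map odd ys) x∈) =
      trans (vmap-≡-∈ ys τ-args z∈) (cong (tv τ ∘ even) (sym (⌊odd/2⌋ z)))
      where
      τ-args : vmap (tv τ ∘ odd) ys ≡ vmap (tv τ ∘ even) ys
      τ-args = trans (Vec.map-∘ (tv τ) odd ys)
                     (trans (args-injective τ-unifies) (sym (Vec.map-∘ (tv τ) even ys)))
    pv-factors : ∀ τ → Unifier τ (applyL oddS P) (applyL evenS P) →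
                 ∀ kk q → pv τ kk q ≡ pv τ kk (θ-pv kk q)
    pv-factors τ τ-unifies kk q with kk ≟ k P | q ≟ odd (pred P)
    ... | yes refl | yes refl = cong pred τ-unifies
    ... | yes _    | no  _    = refl
    ... | no  _    | _        = refl

  halve∘θ : halveS ≗ₛ halveS ∘ₛ θ
  halve∘θ = tv-halve , pv-halve
    where
    tv-halve : ∀ x → ⌊ x /2⌋ ≡ ⌊ θ-tv x /2⌋
    tv-halve x with x ∈? tvars (applyL oddS P)
    ... | yes _ = sym (⌊even/2⌋ _)
    ... | no  _ = refl
    pv-halve : ∀ kk q → ⌊ q /2⌋ ≡ ⌊ θ-pv kk q /2⌋
    pv-halve kk q with kk ≟ k P | q ≟ odd (pred P)
    ... | yes _ | yes refl = trans (⌊odd/2⌋ (pred P)) (sym (⌊even/2⌋ (pred P)))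
    ... | yes _ | no  _    = refl
    ... | no  _ | _        = refl

  halve∘θ∘renameBy : ∀ {f} → (∀ n → ⌊ f n /2⌋ ≡ n) →
                     ∀ L → applyL halveS (applyL θ (applyL (renameBy f) L)) ≡ L
  halve∘θ∘renameBy halve∘f L =
    trans (applyL-∘ {halveS} {halveS} {θ} halve∘θ _) (halve-renameBy halve∘f L)

ResolvesFromSmaller : ℕ → Clause → Set
ResolvesFromSmaller a C =
  ∃[ b' ] (b' < size C ×
    ∃[ C₁ ] ∃[ C₂ ] ∃[ R ]
      (InHc a b' C₁ × InHc a b' C₂ × SLD C₁ C₂ R × InstanceOf C R))

reduce-by-resolution :
  ∀ {a b'} C C₁ C₂ P pre post →
  InHc a b' C₁ → InHc a b' C₂ → b' < size C →
  head C₁ ≡ just P → body C₂ ≡ pre ++ P ∷ post →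
  head C ≡ head C₂ → body C ↭ body C₁ ++ pre ++ post →
  ResolvesFromSmaller a C
reduce-by-resolution (clause hd _) (clause _ b₁) (clause _ _) P pre post
                     C₁∈ C₂∈ b'<C refl refl refl body↭ =
  _ , b'<C , applyC oddS C₁ , applyC evenS C₂ , R ,
  InHc-applyC oddS C₁ C₁∈ , InHc-applyC evenS C₂ C₂∈ ,
  (Apart-odd-even C₁ C₂ , applyL oddS P , refl ,
   map e pre , applyL evenS P , map e post , map-++ e pre (P ∷ post) , θ , θ-mgu , refl) ,
  halveS , restore-head hd , ↭-trans body↭ (↭-reflexive (sym restore-body))
  where
  open OddEvenMgu P
  e = applyL evenS
  o = applyL oddS
  C₁ = clause (just P) b₁
  C₂ = clause hd (pre ++ P ∷ post)
  R = clause (applyM θ (applyM evenS hd))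
             (map (applyL θ) (map o b₁) ++ map (applyL θ) (map e pre ++ map e post))
  restore-map : ∀ {f} → (∀ n → ⌊ f n /2⌋ ≡ n) → ∀ xs →
                map (applyL halveS) (map (applyL θ) (map (applyL (renameBy f)) xs)) ≡ xs
  restore-map halve∘f []       = refl
  restore-map halve∘f (x ∷ xs) = cong₂ _∷_ (halve∘θ∘renameBy halve∘f x) (restore-map halve∘f xs)
  restore-head : ∀ h → h ≡ applyM halveS (applyM θ (applyM evenS h))
  restore-head nothing  = refl
  restore-head (just h) = cong just (sym (halve∘θ∘renameBy ⌊even/2⌋ h))
  restore-body : map (applyL halveS) (body R) ≡ b₁ ++ pre ++ post
  restore-body = begin
    map h (map (applyL θ) (map o b₁) ++ map (applyL θ) (map e pre ++ map e post))
      ≡⟨ map-++ h (map (applyL θ) (map o b₁)) _ ⟩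
    map h (map (applyL θ) (map o b₁)) ++ map h (map (applyL θ) (map e pre ++ map e post))
      ≡⟨ cong₂ _++_ (restore-map ⌊odd/2⌋ b₁)
                    (cong (map h ∘ map (applyL θ)) (sym (map-++ e pre post))) ⟩
    b₁ ++ map h (map (applyL θ) (map e (pre ++ post)))
      ≡⟨ cong (b₁ ++_) (restore-map ⌊even/2⌋ (pre ++ post)) ⟩
    b₁ ++ pre ++ post ∎
    where
    open ≡-Reasoning
    h = applyL halveS

-- The paper's fresh predicate P(ȳ) for the cut can be Y itself: the premises are renamed
-- apart before resolving, so only the variables of the cut literal matter.
bridge : Literal → Literal → Clause
bridge Y X = clause (just Y) (Y ∷ X ∷ [])

bridge-InHc : ∀ {a b} C {X Y} → AritiesAtMost a C → X ∈ literals C → Y ∈ literals C →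
              ShareVar X Y → 2 ≤ b → InHc a b (bridge Y X)
bridge-InHc C {X} {Y} ar X∈C Y∈C X~Y 2≤b =
  (ChainTo⇒ConnectedLits (here (ShareVar-refl Y) ∷ here X~Y ∷ []) ,
   AritiesAtMost-⊆ C (bridge Y X) (∈-∷⁺ʳ Y∈C (∈-∷⁺ʳ Y∈C (∈-∷⁺ʳ X∈C (λ ())))) ar) ,
  2≤b

headList-∈ : ∀ {h L} → L ∈ headList h → h ≡ just L
headList-∈ {just _} (here refl) = refl

reduce-by-link :
  ∀ {a} C X B′ → InHc∞ a C → 2 < size C → body C ↭ X ∷ B′ →
  Connected (clause (head C) B′) → Any (ShareVar X) (literals (clause (head C) B′)) →
  ResolvesFromSmaller a C
reduce-by-link {a} C X B′ (_ , ar) 2<C body↭ conn X~rest = resolve (find X~rest)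
  where
  rest = clause (head C) B′
  rest⊆C : literals rest ⊆ literals C
  rest⊆C = ++⁺ʳ (headList (head C)) (⊆-trans (xs⊆x∷xs B′ X) (⊆-reflexive-↭ (↭-sym body↭)))
  X∈C : X ∈ literals C
  X∈C = ∈-++⁺ʳ (headList (head C)) (∈-resp-↭ (↭-sym body↭) (here refl))
  B′<C : length B′ < size C
  B′<C = subst (length B′ <_) (sym (↭-length body↭)) ≤-refl
  2≤B′ : 2 ≤ length B′
  2≤B′ = ≤-pred (subst (2 <_) (↭-length body↭) 2<C)
  rest∈ : InHc a (length B′) rest
  rest∈ = (conn , AritiesAtMost-⊆ C rest rest⊆C ar) , ≤-refl
  bridge∈ : ∀ {Y} → Y ∈ literals rest → ShareVar X Y → InHc a (length B′) (bridge Y X)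
  bridge∈ Y∈ X~Y = bridge-InHc C ar X∈C (rest⊆C Y∈) X~Y 2≤B′
  resolve : ∃[ Y ] (Y ∈ literals rest × ShareVar X Y) → ResolvesFromSmaller a C
  resolve (Y , Y∈ , X~Y) with ∈-++⁻ (headList (head C)) Y∈
  ... | inj₁ Y∈head =
    reduce-by-resolution C rest (bridge Y X) Y [] (X ∷ []) rest∈ (bridge∈ Y∈ X~Y) B′<C
      (headList-∈ Y∈head) refl (headList-∈ Y∈head) (↭-trans body↭ (∷↭∷ʳ X B′))
  ... | inj₂ Y∈B′ with pre , post , B′≡ ← ∈-∃++ Y∈B′ =
    reduce-by-resolution C (bridge Y X) rest Y pre post (bridge∈ Y∈ X~Y) rest∈ B′<C
      refl B′≡ refl
      (↭-trans body↭ (↭-trans (prep X (↭-trans (↭-reflexive B′≡) (shift Y pre post)))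
                              (swap X Y ↭-refl)))

mainTheorem4 : (a : ℕ) → 1 ≤ a → ReducibleHc a 2
mainTheorem4 a _ C@(clause (just H) body) inC@(conn , _) 2<C = reduce (chainOrdering conn)
  where
  reduce : ∃[ M ] (M ↭ body × ChainTo H M) → ResolvesFromSmaller a C
  reduce ([] , []↭body , _) = ⊥-elim (n≮0 (subst (2 <_) (sym (↭-length []↭body)) 2<C))
  reduce (X ∷ M , M↭body , X~ ∷ chain) =
    reduce-by-link C X M inC 2<C (↭-sym M↭body) (ChainTo⇒ConnectedLits chain) X~
mainTheorem4 a _ (clause nothing []) _ ()
mainTheorem4 a _ C@(clause nothing (r ∷ B)) inC@(conn , _) 2<C = reduce (chainOrdering conn)
  where
  reduce : ∃[ M ] (M ↭ B × ChainTo r M) → ResolvesFromSmaller a C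
  reduce ([] , []↭B , _) =
    ⊥-elim (n≮0 (≤-pred (subst (λ n → 2 < suc n) (sym (↭-length []↭B)) 2<C)))
  reduce (X ∷ M , M↭B , X~ ∷ chain) =
    reduce-by-link C X (r ∷ M) inC 2<C (↭-trans (prep r (↭-sym M↭B)) (swap r X ↭-refl))
      (ChainTo⇒ConnectedLits chain) X~
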